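{- Let $\mathcal{H}$ be a hypergraph and let $a \in \mathbb{Z}_+$. If Maker wins the $(a,1)$-game on $\mathcal{H}$, then $\mathcal{H}$ contains either an edge of size at most $1$ or an $a$-reducible pair of edges.
   Context: A hypergraph $\mathcal{H}$ consists of a finite vertex set $V(\mathcal{H})$ and a set $E(\mathcal{H})$ of subsets of $V(\mathcal{H})$ (edges). A pair $(e_1,e_2)$ of distinct edges is $a$-reducible if $|e_1\cap e_2| \geq |e_1|+|e_2|-a-2$ (possibly $e_1\cap e_2=\varnothing$). The $(a,b)$-game on $\mathcal{H}$: Maker has $a$ tokens and Breaker has $b$ tokens; initially the board is empty. Players alternate turns, Maker first. On a turn a player may pass, or place one of their own tokens on an unoccupied vertex, the token being either not yet used or moved from its current vertex on the board (which becomes unoccupied). Maker wins as soon as all vertices of some edge carry Maker tokens; Breaker wins if this never happens or if the game reaches the same state twice. "Maker wins" means Maker has a winning strategy. -}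

module Defs where

open import Data.Nat using (ℕ; zero; suc; _+_; _≤_; _<_)
open import Data.Fin using (Fin)
open import Data.Vec using (Vec; []; _∷_; lookup; _[_]≔_)
open import Data.Fin.Subset using (Subset; _∩_; ∣_∣) renaming (_∈_ to _∈ₛ_)
open import Data.List using (List; _∷_) renaming ([] to nil)
open import Data.List.Membership.Propositional using (_∈_; _∉_)
open import Data.Product using (Σ; ∃; _×_; _,_)
open import Relation.Binary.PropositionalEquality using (_≡_; _≢_)

-- A hypergraph on the vertex set Fin n; edges are subsets of Fin n,
-- the (finite) edge set is given as a list (duplicates are harmless).
record Hypergraph (n : ℕ) : Set where
  constructor hypergraph
  field
    edges : List (Subset n)
open Hypergraph public

-- a-reducible pair: |e₁ ∩ e₂| ≥ |e₁| + |e₂| - a - 2, written without subtraction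
Reducible : ∀ {n} → ℕ → Subset n → Subset n → Set
Reducible a e₁ e₂ = ∣ e₁ ∣ + ∣ e₂ ∣ ≤ ∣ e₁ ∩ e₂ ∣ + a + 2

data Player : Set where
  maker breaker : Player

data Cell : Set where
  empty : Cell
  occ   : Player → Cell

Board : ℕ → Set
Board n = Vec Cell n

onBoard : ∀ {n} → Player → Board n → ℕ
onBoard p [] = 0
onBoard maker (occ maker ∷ B) = suc (onBoard maker B)
onBoard breaker (occ breaker ∷ B) = suc (onBoard breaker B)
onBoard p (_ ∷ B) = onBoard p B

data Step {n : ℕ} (p : Player) (t : ℕ) (B : Board n) : Board n → Set where
  pass  : Step p t B B
  place : (v : Fin n) → onBoard p B < t → lookup B v ≡ empty →
          Step p t B (B [ v ]≔ occ p)
  shift : (u v : Fin n) → lookup B u ≡ occ p → lookup B v ≡ empty →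
          Step p t B ((B [ u ]≔ empty) [ v ]≔ occ p)

record State (n : ℕ) : Set where
  constructor st
  field
    board : Board n
    toMove : Player
open State public

initial : ∀ {n} → State n
initial {zero} = st [] maker
initial {suc n} = st (empty ∷ board (initial {n})) maker

tokensOf : Player → ℕ → ℕ → ℕ
tokensOf maker a b = a
tokensOf breaker a b = b

other : Player → Player
other maker = breaker
other breaker = maker

Move : ∀ {n} → ℕ → ℕ → State n → State n → Set
Move a b s s' = Step (toMove s) (tokensOf (toMove s) a b) (board s) (board s')
              × toMove s' ≡ other (toMove s)

MakerComplete : ∀ {n} → Hypergraph n → Board n → Set
MakerComplete {n} H B = Σ (Subset n) λ e → e ∈ edges H × (∀ v → v ∈ₛ e → lookup B v ≡ occ maker)

-- MakerForces H a b hist s : Maker can force a win from state s, where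
-- hist is the list of states that occurred earlier in the play.
-- Breaker wins if a state repeats; plays without repetition are finite,
-- so an inductive (well-founded) strategy tree is a winning strategy.
data MakerForces {n : ℕ} (H : Hypergraph n) (a b : ℕ) (hist : List (State n)) (s : State n) : Set where
  won     : MakerComplete H (board s) → MakerForces H a b hist s
  makerTo : toMove s ≡ maker → s ∉ hist → (s' : State n) → Move a b s s' →
            MakerForces H a b (s ∷ hist) s' → MakerForces H a b hist s
  breakerAll : toMove s ≡ breaker → s ∉ hist →
            ((s' : State n) → Move a b s s' → MakerForces H a b (s ∷ hist) s') →
            MakerForces H a b hist s

MakerWins : ∀ {n} → Hypergraph n → ℕ → ℕ → Set
MakerWins H a b = MakerForces H a b nil initial

-- Assume every edge has at least two vertices and no pair of edges is a-reducible; Breaker then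
-- never loses. Call x a threat if some edge lies inside Maker's vertices together with x. Breaker
-- keeps the invariant that, whenever Maker is to move, every threat carries Breaker's token.
-- A Maker move adds at most one vertex to Maker's territory, and it was empty, so it cannot
-- complete an edge. Afterwards there is at most one threat: threats x ≠ y in edges e₁, e₂ give
-- either e₁ = e₂ inside Maker's territory, or e₁ ∪ e₂ inside Maker's (at most a) vertices and
-- {x, y}, which makes (e₁, e₂) a-reducible. So Breaker restores the invariant by putting its single
-- token on that threat. On the empty board the threats are exactly the vertices of edges of size
-- at most one, of which there are none.
module Submission where

open import Defs
open import Data.Bool using (Bool; true; false)
import Data.Bool.Properties as Bool
open import Data.Empty using (⊥-elim)
open import Data.Fin using (Fin; _≟_)
import Data.Fin.Properties as Fin
open import Data.Fin.Subset
  using (Subset; ∣_∣; _∪_; _∩_; _-_; _⊆_; ⁅_⁆; inside; outside; Nonempty)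
  renaming (_∈_ to _∈ₛ_; _∉_ to _∉ₛ_; ⊥ to ∅)
open import Data.Fin.Subset.Properties
  using ( _⊆?_; ⊆-refl; ⊆-trans; nonempty?; Empty-unique; ∣⊥∣≡0; ∣⁅x⁆∣≡1; x∈⁅x⁆; x∈⁅y⁆⇒x≡y
        ; x∈p∪q⁺; x∈p∪q⁻; p─q⊆p; x∈p∧x≢y⇒x∈p-y; p⊆q⇒∣p∣≤∣q∣; x∈p⇒∣p-x∣<∣p∣ )
open import Data.List using (List)
open import Data.List.Membership.Propositional using (_∈_; find; lose)
open import Data.List.Relation.Unary.Any using (any?)
open import Data.Nat using (ℕ; zero; suc; _+_; _≤_; _<_; z≤n; s≤s; _≤?_)
open import Data.Nat.Properties
  using (≤-trans; ≤-reflexive; +-suc; +-comm; +-assoc; +-mono-≤; +-monoˡ-≤; m≤m+n; module ≤-Reasoning)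
open import Data.Product using (Σ; ∃; _×_; _,_; proj₂)
open import Data.Sum using (_⊎_; inj₁; inj₂)
import Data.Sum as Sum
open import Data.Vec using ([]; _∷_; lookup; map; replicate; _[_]≔_)
open import Data.Vec.Properties
  using (≡-dec; []=⇒lookup; lookup⇒[]=; lookup-map; lookup∘update; lookup∘update′; map-replicate)
open import Function using (_∘_)
open import Relation.Binary.PropositionalEquality
  using (_≡_; _≢_; refl; sym; trans; cong; cong₂; subst; module ≡-Reasoning)
open import Relation.Nullary using (Dec; yes; no; ¬_; ¬?)
open import Relation.Nullary.Decidable using (map′; _×-dec_)
open import Relation.Unary using (Decidable)

private
  variable
    n : ℕ

∃∈? : ∀ {A : Set} {P : A → Set} → Decidable P → (xs : List A) → Dec (∃ λ x → x ∈ xs × P x)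
∃∈? P? xs = map′ find (λ (_ , x∈ , px) → lose x∈ px) (any? P? xs)

∣p∪q∣+∣p∩q∣≡∣p∣+∣q∣ : (p q : Subset n) → ∣ p ∪ q ∣ + ∣ p ∩ q ∣ ≡ ∣ p ∣ + ∣ q ∣
∣p∪q∣+∣p∩q∣≡∣p∣+∣q∣ []            []            = refl
∣p∪q∣+∣p∩q∣≡∣p∣+∣q∣ (outside ∷ p) (outside ∷ q) = ∣p∪q∣+∣p∩q∣≡∣p∣+∣q∣ p q
∣p∪q∣+∣p∩q∣≡∣p∣+∣q∣ (inside  ∷ p) (outside ∷ q) = cong suc (∣p∪q∣+∣p∩q∣≡∣p∣+∣q∣ p q)
∣p∪q∣+∣p∩q∣≡∣p∣+∣q∣ (outside ∷ p) (inside  ∷ q) =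
  trans (cong suc (∣p∪q∣+∣p∩q∣≡∣p∣+∣q∣ p q)) (sym (+-suc ∣ p ∣ ∣ q ∣))
∣p∪q∣+∣p∩q∣≡∣p∣+∣q∣ (inside  ∷ p) (inside  ∷ q) = cong suc (begin
  ∣ p ∪ q ∣ + suc ∣ p ∩ q ∣    ≡⟨ +-suc ∣ p ∪ q ∣ ∣ p ∩ q ∣ ⟩
  suc (∣ p ∪ q ∣ + ∣ p ∩ q ∣)  ≡⟨ cong suc (∣p∪q∣+∣p∩q∣≡∣p∣+∣q∣ p q) ⟩
  suc (∣ p ∣ + ∣ q ∣)          ≡⟨ sym (+-suc ∣ p ∣ ∣ q ∣) ⟩
  ∣ p ∣ + suc ∣ q ∣            ∎)
  where open ≡-Reasoning

∣p∪q∣≤∣p∣+∣q∣ : (p q : Subset n) → ∣ p ∪ q ∣ ≤ ∣ p ∣ + ∣ q ∣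
∣p∪q∣≤∣p∣+∣q∣ p q = subst (∣ p ∪ q ∣ ≤_) (∣p∪q∣+∣p∩q∣≡∣p∣+∣q∣ p q) (m≤m+n ∣ p ∪ q ∣ ∣ p ∩ q ∣)

∪-mono-⊆ : {p p′ q q′ : Subset n} → p ⊆ p′ → q ⊆ q′ → p ∪ q ⊆ p′ ∪ q′
∪-mono-⊆ {p = p} {q = q} p⊆p′ q⊆q′ x∈p∪q = x∈p∪q⁺ (Sum.map p⊆p′ q⊆q′ (x∈p∪q⁻ p q x∈p∪q))

⊆∪⁅x⁆⇒⊆ : {p q : Subset n} {x : Fin n} → x ∈ₛ p → q ⊆ p ∪ ⁅ x ⁆ → q ⊆ p
⊆∪⁅x⁆⇒⊆ {p = p} {x = x} x∈p q⊆ v∈q with x∈p∪q⁻ p ⁅ x ⁆ (q⊆ v∈q)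
... | inj₁ v∈p   = v∈p
... | inj₂ v∈⁅x⁆ = subst (_∈ₛ p) (sym (x∈⁅y⁆⇒x≡y x v∈⁅x⁆)) x∈p

⊆∪⁅x⁆∩⊆∪⁅y⁆⇒⊆ : {p q : Subset n} {x y : Fin n} → x ≢ y → q ⊆ p ∪ ⁅ x ⁆ → q ⊆ p ∪ ⁅ y ⁆ → q ⊆ p
⊆∪⁅x⁆∩⊆∪⁅y⁆⇒⊆ {p = p} {x = x} {y} x≢y q⊆x q⊆y v∈q
  with x∈p∪q⁻ p ⁅ x ⁆ (q⊆x v∈q) | x∈p∪q⁻ p ⁅ y ⁆ (q⊆y v∈q)
... | inj₁ v∈p    | _          = v∈p
... | inj₂ _      | inj₁ v∈p   = v∈p
... | inj₂ v∈⁅x⁆ | inj₂ v∈⁅y⁆ = ⊥-elim (x≢y (trans (sym (x∈⁅y⁆⇒x≡y x v∈⁅x⁆)) (x∈⁅y⁆⇒x≡y y v∈⁅y⁆)))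

covered-pair-reducible : ∀ {a} {M e₁ e₂ : Subset n} {x y : Fin n} → ∣ M ∣ ≤ a →
                         e₁ ⊆ M ∪ ⁅ x ⁆ → e₂ ⊆ M ∪ ⁅ y ⁆ → Reducible a e₁ e₂
covered-pair-reducible {a = a} {M} {e₁} {e₂} {x} {y} ∣M∣≤a e₁⊆ e₂⊆ = begin
  ∣ e₁ ∣ + ∣ e₂ ∣                         ≡⟨ sym (∣p∪q∣+∣p∩q∣≡∣p∣+∣q∣ e₁ e₂) ⟩
  ∣ e₁ ∪ e₂ ∣ + ∣ e₁ ∩ e₂ ∣               ≤⟨ +-monoˡ-≤ ∣ e₁ ∩ e₂ ∣ (p⊆q⇒∣p∣≤∣q∣ cover) ⟩
  ∣ M ∪ (⁅ x ⁆ ∪ ⁅ y ⁆) ∣ + ∣ e₁ ∩ e₂ ∣   ≤⟨ +-monoˡ-≤ ∣ e₁ ∩ e₂ ∣ ∣cover∣≤a+2 ⟩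
  a + 2 + ∣ e₁ ∩ e₂ ∣                     ≡⟨ +-comm (a + 2) ∣ e₁ ∩ e₂ ∣ ⟩
  ∣ e₁ ∩ e₂ ∣ + (a + 2)                   ≡⟨ sym (+-assoc ∣ e₁ ∩ e₂ ∣ a 2) ⟩
  ∣ e₁ ∩ e₂ ∣ + a + 2                     ∎
  where
  open ≤-Reasoning
  cover : e₁ ∪ e₂ ⊆ M ∪ (⁅ x ⁆ ∪ ⁅ y ⁆)
  cover v∈ with x∈p∪q⁻ e₁ e₂ v∈
  ... | inj₁ v∈e₁ = ∪-mono-⊆ ⊆-refl (λ v∈⁅x⁆ → x∈p∪q⁺ (inj₁ v∈⁅x⁆)) (e₁⊆ v∈e₁)
  ... | inj₂ v∈e₂ = ∪-mono-⊆ ⊆-refl (λ v∈⁅y⁆ → x∈p∪q⁺ (inj₂ v∈⁅y⁆)) (e₂⊆ v∈e₂)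
  ∣cover∣≤a+2 : ∣ M ∪ (⁅ x ⁆ ∪ ⁅ y ⁆) ∣ ≤ a + 2
  ∣cover∣≤a+2 = begin
    ∣ M ∪ (⁅ x ⁆ ∪ ⁅ y ⁆) ∣           ≤⟨ ∣p∪q∣≤∣p∣+∣q∣ M (⁅ x ⁆ ∪ ⁅ y ⁆) ⟩
    ∣ M ∣ + ∣ ⁅ x ⁆ ∪ ⁅ y ⁆ ∣         ≤⟨ +-mono-≤ ∣M∣≤a (∣p∪q∣≤∣p∣+∣q∣ ⁅ x ⁆ ⁅ y ⁆) ⟩
    a + (∣ ⁅ x ⁆ ∣ + ∣ ⁅ y ⁆ ∣)       ≡⟨ cong (a +_) (cong₂ _+_ (∣⁅x⁆∣≡1 x) (∣⁅x⁆∣≡1 y)) ⟩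
    a + 2                             ∎

owns : Player → Cell → Bool
owns _       empty         = false
owns maker   (occ maker)   = true
owns maker   (occ breaker) = false
owns breaker (occ maker)   = false
owns breaker (occ breaker) = true

owns⇒≡occ : ∀ p c → owns p c ≡ true → c ≡ occ p
owns⇒≡occ maker   (occ maker)   _ = refl
owns⇒≡occ breaker (occ breaker) _ = refl

owns-occ : ∀ p → owns p (occ p) ≡ true
owns-occ maker   = refl
owns-occ breaker = refl

occ≢occ-other : ∀ p → occ p ≢ occ (other p)
occ≢occ-other maker   ()
occ≢occ-other breaker ()

≡⊎≡other : ∀ p q → q ≡ p ⊎ q ≡ other p
≡⊎≡other maker   maker   = inj₁ refl
≡⊎≡other maker   breaker = inj₂ refl
≡⊎≡other breaker maker   = inj₂ refl
≡⊎≡other breaker breaker = inj₁ refl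

territory : Player → Board n → Subset n
territory p = map (owns p)

∈-territory⁻ : ∀ {p} {B : Board n} {x} → x ∈ₛ territory p B → lookup B x ≡ occ p
∈-territory⁻ {p = p} {B} {x} x∈ =
  owns⇒≡occ p (lookup B x) (trans (sym (lookup-map x (owns p) B)) ([]=⇒lookup x∈))

∈-territory⁺ : ∀ {p} {B : Board n} {x} → lookup B x ≡ occ p → x ∈ₛ territory p B
∈-territory⁺ {p = p} {B} {x} Bx≡p =
  lookup⇒[]= x (territory p B) (trans (lookup-map x (owns p) B) (trans (cong (owns p) Bx≡p) (owns-occ p)))

∣territory∣≡onBoard : ∀ p (B : Board n) → ∣ territory p B ∣ ≡ onBoard p B
∣territory∣≡onBoard p       []                   = refl
∣territory∣≡onBoard maker   (occ maker   ∷ B)    = cong suc (∣territory∣≡onBoard maker B)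
∣territory∣≡onBoard breaker (occ breaker ∷ B)    = cong suc (∣territory∣≡onBoard breaker B)
∣territory∣≡onBoard maker   (occ breaker ∷ B)    = ∣territory∣≡onBoard maker B
∣territory∣≡onBoard breaker (occ maker   ∷ B)    = ∣territory∣≡onBoard breaker B
∣territory∣≡onBoard maker   (empty ∷ B)          = ∣territory∣≡onBoard maker B
∣territory∣≡onBoard breaker (empty ∷ B)          = ∣territory∣≡onBoard breaker B

territory-replicate-empty : ∀ p → territory p (replicate n empty) ≡ ∅
territory-replicate-empty {n} p = map-replicate (owns p) empty n

territory-update : ∀ p (B : Board n) v c → territory p (B [ v ]≔ c) ⊆ territory p B ∪ ⁅ v ⁆
territory-update p B v c {x} x∈ with x ≟ v
... | yes refl = x∈p∪q⁺ (inj₂ (x∈⁅x⁆ x))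
... | no x≢v   = x∈p∪q⁺ (inj₁ (∈-territory⁺ (trans (sym (lookup∘update′ x≢v B c)) (∈-territory⁻ x∈))))

territory-update-≢ : ∀ p (B : Board n) v {c} → c ≢ occ p → territory p (B [ v ]≔ c) ⊆ territory p B - v
territory-update-≢ p B v {c} c≢p {x} x∈ with x ≟ v
... | yes refl = ⊥-elim (c≢p (trans (sym (lookup∘update x B c)) (∈-territory⁻ x∈)))
... | no x≢v   = x∈p∧x≢y⇒x∈p-y (∈-territory⁺ (trans (sym (lookup∘update′ x≢v B c)) (∈-territory⁻ x∈))) x≢v

territory-update-⊆ : ∀ p (B : Board n) v {c} → c ≢ occ p → territory p (B [ v ]≔ c) ⊆ territory p B
territory-update-⊆ p B v c≢p = p─q⊆p (territory p B) ⁅ v ⁆ ∘ territory-update-≢ p B v c≢p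

step-territory : ∀ {p t} {B B′ : Board n} → Step p t B B′ →
                 territory p B′ ⊆ territory p B
                 ⊎ ∃ λ v → lookup B v ≡ empty × territory p B′ ⊆ territory p B ∪ ⁅ v ⁆
step-territory pass = inj₁ ⊆-refl
step-territory {p = p} {B = B} (place v _ v-empty) = inj₂ (v , v-empty , territory-update p B v (occ p))
step-territory {p = p} {B = B} (shift u v _ v-empty) = inj₂ (v , v-empty ,
  ∪-mono-⊆ (territory-update-⊆ p B u (λ ())) ⊆-refl ∘ territory-update p (B [ u ]≔ empty) v (occ p))

∣territory-update∣≤ : ∀ p (B : Board n) v c → ∣ territory p (B [ v ]≔ c) ∣ ≤ suc ∣ territory p B ∣
∣territory-update∣≤ p B v c = begin
  ∣ territory p (B [ v ]≔ c) ∣      ≤⟨ p⊆q⇒∣p∣≤∣q∣ (territory-update p B v c) ⟩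
  ∣ territory p B ∪ ⁅ v ⁆ ∣         ≤⟨ ∣p∪q∣≤∣p∣+∣q∣ (territory p B) ⁅ v ⁆ ⟩
  ∣ territory p B ∣ + ∣ ⁅ v ⁆ ∣     ≡⟨ cong (∣ territory p B ∣ +_) (∣⁅x⁆∣≡1 v) ⟩
  ∣ territory p B ∣ + 1             ≡⟨ +-comm ∣ territory p B ∣ 1 ⟩
  suc ∣ territory p B ∣             ∎
  where open ≤-Reasoning

step-count : ∀ {p t} {B B′ : Board n} → Step p t B B′ → ∣ territory p B ∣ ≤ t → ∣ territory p B′ ∣ ≤ t
step-count pass bound = bound
step-count {p = p} {t} {B} (place v below _) _ =
  ≤-trans (∣territory-update∣≤ p B v (occ p)) (subst (λ k → suc k ≤ t) (sym (∣territory∣≡onBoard p B)) below)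
step-count {p = p} {t} {B} (shift u v u-owned _) bound = begin
  ∣ territory p (B₁ [ v ]≔ occ p) ∣  ≤⟨ ∣territory-update∣≤ p B₁ v (occ p) ⟩
  suc ∣ territory p B₁ ∣             ≤⟨ s≤s (p⊆q⇒∣p∣≤∣q∣ (territory-update-≢ p B u (λ ()))) ⟩
  suc ∣ territory p B - u ∣          ≤⟨ x∈p⇒∣p-x∣<∣p∣ (∈-territory⁺ {B = B} u-owned) ⟩
  ∣ territory p B ∣                  ≤⟨ bound ⟩
  t                                  ∎
  where
  open ≤-Reasoning
  B₁ = B [ u ]≔ empty

occupy : ∀ {p t} (B : Board n) x → 0 < t → x ∉ₛ territory (other p) B →
         ∃ λ B′ → Step p t B B′ × lookup B′ x ≡ occ p × territory (other p) B′ ⊆ territory (other p) B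
occupy {p = p} B x 0<t x∉ with lookup B x in Bx
... | occ q with ≡⊎≡other p q
...   | inj₁ refl = B , pass , Bx , ⊆-refl
...   | inj₂ refl = ⊥-elim (x∉ (∈-territory⁺ Bx))
occupy {n} {p = p} {t} B x 0<t x∉ | empty with nonempty? (territory p B)
... | yes (u , u∈) =
  B₁ [ x ]≔ occ p , shift u x (∈-territory⁻ u∈) Bx , lookup∘update x B₁ (occ p) ,
  territory-update-⊆ (other p) B u (λ ()) ∘ territory-update-⊆ (other p) B₁ x (occ≢occ-other p)
  where B₁ = B [ u ]≔ empty
... | no none =
  B [ x ]≔ occ p , place x (subst (_< t) (sym none-on-board) 0<t) Bx , lookup∘update x B (occ p) ,
  territory-update-⊆ (other p) B x (occ≢occ-other p)
  where
  none-on-board : onBoard p B ≡ 0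
  none-on-board = trans (sym (∣territory∣≡onBoard p B)) (trans (cong ∣_∣ (Empty-unique none)) (∣⊥∣≡0 n))

initial≡ : initial {n} ≡ st (replicate n empty) maker
initial≡ {zero}  = refl
initial≡ {suc n} = cong (λ s → st (empty ∷ board s) maker) (initial≡ {n})

module BreakerBlocks {n} (H : Hypergraph n) (a : ℕ)
  (large       : ∀ {e} → e ∈ edges H → ¬ ∣ e ∣ ≤ 1)
  (irreducible : ∀ {e₁ e₂} → e₁ ∈ edges H → e₂ ∈ edges H → e₁ ≢ e₂ → ¬ Reducible a e₁ e₂)
  where

  private
    M : Board n → Subset n
    M = territory maker

  Guarded : Board n → Set
  Guarded B = ∀ {e x} → e ∈ edges H → e ⊆ M B ∪ ⁅ x ⁆ → lookup B x ≡ occ breaker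

  Unclaimed : Board n → Set
  Unclaimed B = ∀ {e} → e ∈ edges H → ¬ e ⊆ M B

  Safe : Player → Board n → Set
  Safe maker   B = ∣ M B ∣ ≤ a × Guarded B
  Safe breaker B = ∣ M B ∣ ≤ a × Unclaimed B

  edge-nonempty : ∀ {e} → e ∈ edges H → Nonempty e
  edge-nonempty {e} e∈ with nonempty? e
  ... | yes ne      = ne
  ... | no e-empty = ⊥-elim (large e∈ (≤-trans (≤-reflexive (trans (cong ∣_∣ (Empty-unique e-empty)) (∣⊥∣≡0 n))) z≤n))

  guarded⇒unclaimed : ∀ {B} → Guarded B → Unclaimed B
  guarded⇒unclaimed {B} guarded e∈ e⊆M with edge-nonempty e∈
  ... | x , x∈e with trans (sym (∈-territory⁻ {B = B} (e⊆M x∈e))) (guarded e∈ (x∈p∪q⁺ ∘ inj₁ ∘ e⊆M))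
  ... | ()

  safe⇒unclaimed : ∀ p {B} → Safe p B → Unclaimed B
  safe⇒unclaimed maker   = guarded⇒unclaimed ∘ proj₂
  safe⇒unclaimed breaker = proj₂

  threat-unowned : ∀ {B e x} → Unclaimed B → e ∈ edges H → e ⊆ M B ∪ ⁅ x ⁆ → x ∉ₛ M B
  threat-unowned unclaimed e∈ e⊆ x∈M = unclaimed e∈ (⊆∪⁅x⁆⇒⊆ x∈M e⊆)

  threat-unique : ∀ {B e₁ e₂ x y} → ∣ M B ∣ ≤ a → Unclaimed B → e₁ ∈ edges H → e₂ ∈ edges H →
                  e₁ ⊆ M B ∪ ⁅ x ⁆ → e₂ ⊆ M B ∪ ⁅ y ⁆ → x ≡ y
  threat-unique {e₁ = e₁} {e₂} {x} {y} bound unclaimed e₁∈ e₂∈ e₁⊆ e₂⊆ with ≡-dec Bool._≟_ e₁ e₂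
  ... | no e₁≢e₂ = ⊥-elim (irreducible e₁∈ e₂∈ e₁≢e₂ (covered-pair-reducible bound e₁⊆ e₂⊆))
  ... | yes refl with x ≟ y
  ...   | yes x≡y = x≡y
  ...   | no x≢y  = ⊥-elim (unclaimed e₁∈ (⊆∪⁅x⁆∩⊆∪⁅y⁆⇒⊆ x≢y e₁⊆ e₂⊆))

  maker-step-safe : ∀ {B B′} → Step maker a B B′ → Safe maker B → Safe breaker B′
  maker-step-safe step (bound , guarded) = step-count step bound , unclaimed
    where
    unclaimed : Unclaimed _
    unclaimed e∈ e⊆ with step-territory step
    ... | inj₁ M′⊆M = guarded⇒unclaimed guarded e∈ (⊆-trans e⊆ M′⊆M)
    ... | inj₂ (v , v-empty , M′⊆) with trans (sym v-empty) (guarded e∈ (⊆-trans e⊆ M′⊆))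
    ... | ()

  breaker-reply : ∀ {B} → Safe breaker B → ∃ λ B′ → Step breaker 1 B B′ × Safe maker B′
  breaker-reply {B} (bound , unclaimed)
    with Fin.any? (λ x → ∃∈? (λ e → e ⊆? M B ∪ ⁅ x ⁆) (edges H))
  ... | no no-threat = B , pass , bound , λ e∈ e⊆ → ⊥-elim (no-threat (_ , _ , e∈ , e⊆))
  ... | yes (x , e , e∈ , e⊆) with occupy B x (s≤s z≤n) (threat-unowned unclaimed e∈ e⊆)
  ...   | B′ , step , x-blocked , M′⊆M = B′ , step , ≤-trans (p⊆q⇒∣p∣≤∣q∣ M′⊆M) bound , guarded
    where
    guarded : Guarded B′
    guarded e′∈ e′⊆ = subst (λ y → lookup B′ y ≡ occ breaker)
      (threat-unique bound unclaimed e∈ e′∈ e⊆ (⊆-trans e′⊆ (∪-mono-⊆ M′⊆M ⊆-refl))) x-blocked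

  empty-board-safe : Safe maker (replicate n empty)
  empty-board-safe = ≤-trans (≤-reflexive ∣M∣≡0) z≤n , guarded
    where
    ∣M∣≡0 : ∣ M (replicate n empty) ∣ ≡ 0
    ∣M∣≡0 = trans (cong ∣_∣ (territory-replicate-empty {n} maker)) (∣⊥∣≡0 n)
    guarded : Guarded (replicate n empty)
    guarded {e} {x} e∈ e⊆ = ⊥-elim (large e∈ (begin
      ∣ e ∣                                 ≤⟨ p⊆q⇒∣p∣≤∣q∣ e⊆ ⟩
      ∣ M (replicate n empty) ∪ ⁅ x ⁆ ∣     ≤⟨ ∣p∪q∣≤∣p∣+∣q∣ (M (replicate n empty)) ⁅ x ⁆ ⟩
      ∣ M (replicate n empty) ∣ + ∣ ⁅ x ⁆ ∣ ≡⟨ cong₂ _+_ ∣M∣≡0 (∣⁅x⁆∣≡1 x) ⟩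
      1                                     ∎))
      where open ≤-Reasoning

  maker-loses : ∀ {hist s} → MakerForces H a 1 hist s → ¬ Safe (toMove s) (board s)
  maker-loses {s = st B p} (won (e , e∈ , complete)) safe =
    safe⇒unclaimed p safe e∈ (λ v∈e → ∈-territory⁺ (complete _ v∈e))
  maker-loses {s = st B maker} (makerTo _ _ (st B′ _) (step , refl) rest) safe =
    maker-loses rest (maker-step-safe step safe)
  maker-loses {s = st B breaker} (breakerAll _ _ continue) safe with breaker-reply safe
  ... | B′ , step , safe′ = maker-loses (continue (st B′ maker) (step , refl)) safe′

  maker-does-not-win : ¬ MakerWins H a 1
  maker-does-not-win maker-wins = maker-loses (subst (MakerForces H a 1 _) initial≡ maker-wins) empty-board-safe

small-edge? : (H : Hypergraph n) → Dec (Σ (Subset n) λ e → e ∈ edges H × ∣ e ∣ ≤ 1)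
small-edge? H = ∃∈? (λ e → ∣ e ∣ ≤? 1) (edges H)

reducible-pair? : (H : Hypergraph n) (a : ℕ) →
  Dec (Σ (Subset n) λ e₁ → Σ (Subset n) λ e₂ → e₁ ∈ edges H × e₂ ∈ edges H × e₁ ≢ e₂ × Reducible a e₁ e₂)
reducible-pair? H a =
  map′ (λ (e₁ , e₁∈ , e₂ , e₂∈ , r) → e₁ , e₂ , e₁∈ , e₂∈ , r)
       (λ (e₁ , e₂ , e₁∈ , e₂∈ , r) → e₁ , e₁∈ , e₂ , e₂∈ , r)
       (∃∈? (λ e₁ → ∃∈? (λ e₂ → ¬? (≡-dec Bool._≟_ e₁ e₂) ×-dec (∣ e₁ ∣ + ∣ e₂ ∣ ≤? ∣ e₁ ∩ e₂ ∣ + a + 2))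
                       (edges H))
            (edges H))

lemma3p1 : ∀ {n} (H : Hypergraph n) (a : ℕ) → 1 ≤ a → MakerWins H a 1 →
    (Σ (Subset n) λ e → e ∈ edges H × ∣ e ∣ ≤ 1)
    ⊎ (Σ (Subset n) λ e₁ → Σ (Subset n) λ e₂ →
         e₁ ∈ edges H × e₂ ∈ edges H × e₁ ≢ e₂ × Reducible a e₁ e₂)
lemma3p1 H a _ maker-wins with small-edge? H | reducible-pair? H a
... | yes small   | _         = inj₁ small
... | no _        | yes pair  = inj₂ pair
... | no no-small | no no-pair = ⊥-elim (BreakerBlocks.maker-does-not-win H a
  (λ e∈ small → no-small (_ , e∈ , small))
  (λ e₁∈ e₂∈ e₁≢e₂ red → no-pair (_ , _ , e₁∈ , e₂∈ , e₁≢e₂ , red))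
  maker-wins)
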